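{- If $(G,\sigma)$ is a signed graph on $n$ vertices, then $$\chi_c((G,\sigma))=\min\Big\{\tfrac{k}{d} : (G,\sigma)\text{ has a }(k,d)\text{ -coloring and }k\le 4n\Big\};$$ in particular the minimum exists.
   Context: Graphs are simple and finite. A signed graph $(G,\sigma)$ is a graph $G$ with a map $\sigma:E(G)\to\{\pm1\}$. For $x\in\mathbb{R}$ and $r>0$, $[x]_r\in[0,r)$ is the remainder of $x$ modulo $r$ and $|x|_r=\min\{[x]_r,[-x]_r\}$. For positive integers $k\ge 2d$, a $(k,d)$-coloring of $(G,\sigma)$ is a map $c:V(G)\to\mathbb{Z}_k$ such that $|c(v)-\sigma(e)c(w)|_k\ge d$ for every edge $e=vw$. The circular chromatic number is $\chi_c((G,\sigma))=\inf\{k/d : (G,\sigma)\text{ has a }(k,d)\text{ -coloring}\}$. -}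

module Defs where

open import Data.Nat using (ℕ; zero; suc; _≤_; _*_; _⊓_; NonZero)
open import Data.Fin using (Fin; toℕ)
open import Data.Integer using (ℤ; +_; _-_; -_) renaming (_*_ to _*ℤ_)
open import Data.Integer.DivMod using (_%ℕ_)
open import Data.Maybe using (Maybe; just; nothing)
open import Data.Product using (Σ; _×_)
open import Data.Empty using (⊥)
open import Relation.Binary.PropositionalEquality using (_≡_)

data Sgn : Set where
  pos neg : Sgn

sgnℤ : Sgn → ℤ
sgnℤ pos = + 1
sgnℤ neg = - (+ 1)

-- A simple finite signed graph on vertex set Fin n:
-- sign v w ≡ nothing  : no edge vw
-- sign v w ≡ just s   : edge vw with sign s
record SignedGraph (n : ℕ) : Set where
  field
    sign   : Fin n → Fin n → Maybe Sgn
    irrefl : ∀ v → sign v v ≡ nothing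
    symm   : ∀ v w → sign v w ≡ sign w v
open SignedGraph public

circAbs : (k : ℕ) .{{_ : NonZero k}} → ℤ → ℕ
circAbs k x = (x %ℕ k) ⊓ ((- x) %ℕ k)

IsColoring : ∀ {n} (G : SignedGraph n) (k d : ℕ) .{{_ : NonZero k}} → (Fin n → Fin k) → Set
IsColoring G k d c = ∀ v w s → sign G v w ≡ just s →
  d ≤ circAbs k (+ toℕ (c v) - sgnℤ s *ℤ + toℕ (c w))

HasColoring : ∀ {n} → SignedGraph n → ℕ → ℕ → Set
HasColoring G zero d = ⊥
HasColoring {n} G k@(suc _) d = 1 ≤ d × 2 * d ≤ k × Σ (Fin n → Fin k) (IsColoring G k d)

module Submission where

-- A (K , D)-colouring gives every arc of the double cover (v , s) ↦ s·c(v) a winding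
-- number, and a closed walk of length L and total winding W satisfies D·L ≤ K·W. Take
-- p/q maximal among the ratios p/q ≤ K/D with 2q ≤ p ≤ 2n: a closed walk with
-- q·L > p·W would make L/W a larger such ratio, so the arc weights q − p·winding
-- have no positive cycle and admit a potential (longest walks). Antisymmetrising the
-- potential under s ↦ −s yields a (2p , 2q)-colouring. So every colouring is beaten
-- by one with k ≤ 4n, and the least ratio over these finitely many decidable
-- candidates is the circular chromatic number.

open import Defs

open import Data.Empty using (⊥-elim)
open import Data.Fin as Fin using (Fin; toℕ; fromℕ<)
import Data.Fin.Properties as FinP
import Data.Integer
open import Data.Integer as ℤ using (ℤ; +_; -[1+_]; _⊖_; _%ℕ_; _/ℕ_; 0ℤ; 1ℤ)
open import Data.Integer.DivMod using (a≡a%ℕn+[a/ℕn]*n; n%ℕd<d)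
import Data.Integer.Properties as ℤP
open import Data.Integer.Tactic.RingSolver using (solve-∀)
open import Data.List using (List; []; _∷_; _++_; length; map; filter; allFin; upTo; cartesianProduct)
import Data.List.Extrema as Extrema
import Data.List.Membership.DecPropositional as DecMembership
open import Data.List.Membership.Propositional using (_∈_)
open import Data.List.Membership.Propositional.Properties
  using (∈-filter⁺; ∈-map⁺; ∈-++⁺ˡ; ∈-++⁺ʳ; ∈-++⁻; ∈-∃++; ∈-allFin; ∈-upTo⁺; ∈-cartesianProduct⁺)
open import Data.List.Properties using (length-++; length-++-sucʳ; length-map; length-tabulate)
open import Data.List.Relation.Binary.Subset.Propositional using (_⊆_)
open import Data.List.Relation.Unary.All as All using (All)
open import Data.List.Relation.Unary.All.Properties using (all-filter; ¬Any⇒All¬)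
open import Data.List.Relation.Unary.Any using (here; there)
open import Data.List.Relation.Unary.Unique.Propositional using (Unique; []; _∷_)
open import Data.Maybe using (Maybe; just; nothing)
import Data.Maybe.Properties as MaybeP
open import Data.Nat as ℕ using (ℕ; zero; suc; z≤n; s≤s; _∸_; NonZero)
import Data.Nat.Properties as ℕP
import Data.Nat.Tactic.RingSolver as ℕSolver
open import Data.Product using (Σ; Σ-syntax; _×_; _,_; proj₁; proj₂)
open import Data.Product.Properties using (≡-dec)
open import Data.Rational.Unnormalised as ℚ using (ℚᵘ; mkℚᵘ; *≤*)
import Data.Rational.Unnormalised.Properties as ℚP
open import Data.Sum using (_⊎_; inj₁; inj₂)
import Data.Vec.Functional as Vector
open import Function using (id)
open import Relation.Binary.Bundles using (TotalOrder)
open import Relation.Binary.Definitions using (DecidableEquality; tri<; tri≈; tri>)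
open import Relation.Binary.PropositionalEquality
  using (_≡_; _≢_; refl; sym; trans; cong; cong₂; subst; subst₂; module ≡-Reasoning)
open import Relation.Nullary using (¬_; Dec; yes; no)
open import Relation.Nullary.Decidable using (_×-dec_)
open import Relation.Unary using (Decidable)

module _ {k : ℕ} .{{_ : NonZero k}} where

  open Data.Integer using (_+_; _-_; _*_; -_)

  private
    no-wrap : ∀ {r r′} t → r ℕ.< k → + r ≢ + r′ + + suc t * + k
    no-wrap {r} {r′} t r<k eq = ℕP.<⇒≱ r<k (begin
      k                      ≤⟨ ℕP.m≤m+n k (t ℕ.* k) ⟩
      suc t ℕ.* k            ≤⟨ ℕP.m≤n+m _ r′ ⟩
      r′ ℕ.+ suc t ℕ.* k     ≡⟨ ℤP.+-injective (trans (cong (λ z → + r′ + z) (ℤP.pos-* (suc t) k)) (sym eq)) ⟩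
      r                      ∎)
      where open ℕP.≤-Reasoning

    residue-unique : ∀ {r r′} t → r ℕ.< k → r′ ℕ.< k → + r ≡ + r′ + t * + k → r ≡ r′
    residue-unique (+ zero)   _   _    eq = ℤP.+-injective (trans eq (ℤP.+-identityʳ _))
    residue-unique (+ suc t)  r<k _    eq = ⊥-elim (no-wrap t r<k eq)
    residue-unique {r} {r′} -[1+ t ] _ r′<k eq = ⊥-elim (no-wrap t r′<k (begin
      + r′                              ≡⟨ sym (cancel (+ r′) (+ suc t) (+ k)) ⟩
      + r′ + -[1+ t ] * + k + + suc t * + k ≡⟨ cong (_+ + suc t * + k) (sym eq) ⟩
      + r + + suc t * + k               ∎))
      where
        open ≡-Reasoning
        cancel : ∀ (a s c : ℤ) → a + (- s) * c + s * c ≡ a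
        cancel = solve-∀

  %ℕ-unique : ∀ {x r} m → r ℕ.< k → x ≡ + r + m * + k → x %ℕ k ≡ r
  %ℕ-unique {x} {r} m r<k x≡ = residue-unique (m - x /ℕ k) (n%ℕd<d x k) r<k (begin
    + (x %ℕ k)                         ≡⟨ sym (cancel (+ (x %ℕ k)) (x /ℕ k) (+ k)) ⟩
    + (x %ℕ k) + x /ℕ k * + k - x /ℕ k * + k ≡⟨ cong (_- x /ℕ k * + k) (trans (sym (a≡a%ℕn+[a/ℕn]*n x k)) x≡) ⟩
    + r + m * + k - x /ℕ k * + k      ≡⟨ collect (+ r) m (x /ℕ k) (+ k) ⟩
    + r + (m - x /ℕ k) * + k          ∎)
    where
      open ≡-Reasoning
      cancel : ∀ (a q c : ℤ) → a + q * c - q * c ≡ a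
      cancel = solve-∀
      collect : ∀ (a m q c : ℤ) → a + m * c - q * c ≡ a + (m - q) * c
      collect = solve-∀

  ≤-circAbs : ∀ {d y} m → d ℕ.≤ y → y ℕ.+ d ℕ.≤ k → d ℕ.≤ circAbs k (+ y + m * + k)
  ≤-circAbs {zero}  m _ _ = z≤n
  ≤-circAbs {suc d} {y} m d≤y y+d≤k = ℕP.⊓-glb (subst (suc d ℕ.≤_) (sym x%k≡y) d≤y)
                                             (subst (suc d ℕ.≤_) (sym -x%k≡k∸y) d≤k∸y)
    where
      y<k : y ℕ.< k
      y<k = ℕP.<-≤-trans (ℕP.m<m+n y (s≤s z≤n)) y+d≤k
      d≤k∸y : suc d ℕ.≤ k ∸ y
      d≤k∸y = subst (ℕ._≤ k ∸ y) (ℕP.m+n∸m≡n y (suc d)) (ℕP.∸-monoˡ-≤ y y+d≤k)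
      x%k≡y : (+ y + m * + k) %ℕ k ≡ y
      x%k≡y = %ℕ-unique m y<k refl
      -x%k≡k∸y : (- (+ y + m * + k)) %ℕ k ≡ k ∸ y
      -x%k≡k∸y = %ℕ-unique (- m - 1ℤ) (ℕP.∸-monoʳ-< (ℕP.≤-trans (s≤s z≤n) d≤y) (ℕP.<⇒≤ y<k)) (begin
        - (+ y + m * + k)              ≡⟨ negate (+ y) m (+ k) ⟩
        + k - + y + (- m - 1ℤ) * + k   ≡⟨ cong (_+ (- m - 1ℤ) * + k) (trans (ℤP.m-n≡m⊖n k y) (ℤP.⊖-≥ (ℕP.<⇒≤ y<k))) ⟩
        + (k ∸ y) + (- m - 1ℤ) * + k   ∎)
        where
          open ≡-Reasoning
          negate : ∀ (a m c : ℤ) → - (a + m * c) ≡ c - a + (- m - 1ℤ) * c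
          negate = solve-∀

  circAbs-neg : ∀ x → circAbs k (- x) ≡ circAbs k x
  circAbs-neg x = trans (cong (λ z → ((- x) %ℕ k) ℕ.⊓ (z %ℕ k)) (ℤP.neg-involutive x)) (ℕP.⊓-comm _ _)

  ≤-circAbsᶻ : ∀ {d x} m → + d ℤ.≤ x → x ℤ.≤ + k - + d → d ℕ.≤ circAbs k (x + m * + k)
  ≤-circAbsᶻ {d} {+ y} m d≤y y≤k-d = ≤-circAbs m (ℤP.drop‿+≤+ d≤y) (ℤP.drop‿+≤+ (begin
    + y + + d        ≤⟨ ℤP.+-monoˡ-≤ (+ d) y≤k-d ⟩
    + k - + d + + d  ≡⟨ cancel (+ k) (+ d) ⟩
    + k              ∎))
    where
      open ℤP.≤-Reasoning
      cancel : ∀ (a b : ℤ) → a - b + b ≡ a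
      cancel = solve-∀

  private
    1≤circAbs-⊖-ordered : ∀ {a b} → a ℕ.< k → b ℕ.< a → 1 ℕ.≤ circAbs k (a ⊖ b)
    1≤circAbs-⊖-ordered {a} {b} a<k b<a =
      subst (λ z → 1 ℕ.≤ circAbs k z) (trans (ℤP.+-identityʳ _) (sym (ℤP.⊖-≥ (ℕP.<⇒≤ b<a))))
        (≤-circAbs 0ℤ (ℕP.m<n⇒0<n∸m b<a)
          (ℕP.≤-trans (ℕP.≤-reflexive (ℕP.+-comm (a ∸ b) 1)) (ℕP.≤-trans (s≤s (ℕP.m∸n≤m a b)) a<k)))

  1≤circAbs-⊖ : ∀ {a b} → a ℕ.< k → b ℕ.< k → a ≢ b → 1 ℕ.≤ circAbs k (a ⊖ b)
  1≤circAbs-⊖ {a} {b} a<k b<k a≢b with ℕP.<-cmp a b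
  ... | tri< a<b _ _ = subst (1 ℕ.≤_) (sym (trans (cong (circAbs k) (ℤP.⊖-swap a b)) (circAbs-neg (b ⊖ a))))
                         (1≤circAbs-⊖-ordered b<k a<b)
  ... | tri≈ _ a≡b _ = ⊥-elim (a≢b a≡b)
  ... | tri> _ _ b<a = 1≤circAbs-⊖-ordered a<k b<a

  circAbs≤%ℕ : ∀ s x → circAbs k x ℕ.≤ (sgnℤ s * x) %ℕ k
  circAbs≤%ℕ pos x = subst (λ z → circAbs k x ℕ.≤ z %ℕ k) (sym (ℤP.*-identityˡ x)) (ℕP.m⊓n≤m _ _)
  circAbs≤%ℕ neg x = subst (λ z → circAbs k x ℕ.≤ z %ℕ k) (sym (ℤP.-1*i≡-i x)) (ℕP.m⊓n≤n _ _)

  multiple-of-k≡k : ∀ t {s} → t * + k ≡ + s → 0 ℕ.< s → s ℕ.< k ℕ.+ k → t ≡ 1ℤ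
  multiple-of-k≡k (+ zero)        refl ()
  multiple-of-k≡k (+ suc zero)    _ _ _ = refl
  multiple-of-k≡k (+ suc (suc t)) {s} tk≡s _ s<2k = ⊥-elim (ℕP.<⇒≱ s<2k (begin
    k ℕ.+ k                     ≤⟨ ℕP.+-monoʳ-≤ k (ℕP.m≤m+n k (t ℕ.* k)) ⟩
    suc (suc t) ℕ.* k           ≡⟨ ℤP.+-injective (trans (ℤP.pos-* (suc (suc t)) k) tk≡s) ⟩
    s                           ∎))
    where open ℕP.≤-Reasoning
  multiple-of-k≡k -[1+ t ] tk≡s 0<s _
    with ℤP.*-cancelʳ-<-nonNeg {0ℤ} { -[1+ t ]} (+ k) (subst (0ℤ * + k ℤ.<_) (sym tk≡s) (ℤ.+<+ 0<s))
  ... | ()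

module _ {a b ℓ₁ ℓ₂} (O : TotalOrder b ℓ₁ ℓ₂) {A : Set a} (f : A → TotalOrder.Carrier O)
         {p} {P : A → Set p} (P? : Decidable P) where

  open TotalOrder O using (_≤_)
  open Extrema O

  maximiser : (x₀ : A) → P x₀ → (xs : List A) →
              Σ[ m ∈ A ] P m × (∀ {x} → x ∈ xs → P x → f x ≤ f m)
  maximiser x₀ Px₀ xs =
    argmax f x₀ ys , argmax-all f Px₀ (all-filter P? xs) ,
    λ x∈xs Px → All.lookup (f[xs]≤f[argmax] x₀ ys) (∈-filter⁺ P? x∈xs Px)
    where ys = filter P? xs

  minimiser : (x₀ : A) → P x₀ → (xs : List A) →
              Σ[ m ∈ A ] P m × (∀ {x} → x ∈ xs → P x → f m ≤ f x)
  minimiser x₀ Px₀ xs =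
    argmin f x₀ ys , argmin-all f Px₀ (all-filter P? xs) ,
    λ x∈xs Px → All.lookup (f[argmin]≤f[xs] x₀ ys) (∈-filter⁺ P? x∈xs Px)
    where ys = filter P? xs

anyFunction? : ∀ {m k} {P : (Fin m → Fin k) → Set} → (∀ {f g} → (∀ i → f i ≡ g i) → P f → P g) →
               Decidable P → Dec (Σ (Fin m → Fin k) P)
anyFunction? {zero} resp P? with P? (λ ())
... | yes Pf = yes (_ , Pf)
... | no ¬Pf = no λ (f , Pf) → ¬Pf (resp (λ ()) Pf)
anyFunction? {suc m} {P = P} resp P?
  with FinP.any? (λ x → anyFunction? (λ f≗g → resp (λ { Fin.zero → refl ; (Fin.suc i) → f≗g i }))
                                     (λ f → P? (x Vector.∷ f)))
... | yes (x , f , Pf) = yes (x Vector.∷ f , Pf)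
... | no ¬Pf = no λ (f , Pf) →
  ¬Pf (Vector.head f , Vector.tail f , resp (λ { Fin.zero → refl ; (Fin.suc i) → refl }) Pf)

pairsUpTo : ℕ → List (ℕ × ℕ)
pairsUpTo m = cartesianProduct (upTo (suc m)) (upTo (suc m))

∈-pairsUpTo : ∀ {m x y} → x ℕ.≤ m → y ℕ.≤ m → (x , y) ∈ pairsUpTo m
∈-pairsUpTo x≤m y≤m = ∈-cartesianProduct⁺ (∈-upTo⁺ (s≤s x≤m)) (∈-upTo⁺ (s≤s y≤m))

-- k ÷ d stands for k/d only when d ≥ 1 (for d = 0 it is junk).
_÷_ : ℕ → ℕ → ℚᵘ
k ÷ d = mkℚᵘ (+ k) (ℕ.pred d)

÷-≤⁺ : ∀ {k d k′ d′} → 1 ℕ.≤ d → 1 ℕ.≤ d′ → k ℕ.* d′ ℕ.≤ k′ ℕ.* d → k ÷ d ℚ.≤ k′ ÷ d′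
÷-≤⁺ {k} {suc d} {k′} {suc d′} _ _ kd′≤k′d =
  *≤* (subst₂ ℤ._≤_ (ℤP.pos-* k (suc d′)) (ℤP.pos-* k′ (suc d)) (ℤ.+≤+ kd′≤k′d))

÷-≤⁻ : ∀ {k d k′ d′} → 1 ℕ.≤ d → 1 ℕ.≤ d′ → k ÷ d ℚ.≤ k′ ÷ d′ → k ℕ.* d′ ℕ.≤ k′ ℕ.* d
÷-≤⁻ {k} {suc d} {k′} {suc d′} _ _ (*≤* kd′≤k′d) =
  ℤP.drop‿+≤+ (subst₂ ℤ._≤_ (sym (ℤP.pos-* k (suc d′))) (sym (ℤP.pos-* k′ (suc d))) kd′≤k′d)

unique-length≤ : ∀ {A : Set} {xs ys : List A} → Unique xs → xs ⊆ ys → length xs ℕ.≤ length ys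
unique-length≤ {xs = []} _ _ = z≤n
unique-length≤ {xs = x ∷ xs} (x∉xs ∷ unique) xs⊆ys with ∈-∃++ (xs⊆ys (here refl))
... | ys₁ , ys₂ , refl = subst (suc (length xs) ℕ.≤_) (sym (length-++-sucʳ ys₁ x ys₂))
  (s≤s (unique-length≤ unique (λ z∈xs → skip (xs⊆ys (there z∈xs)) (All.lookup x∉xs z∈xs))))
  where
    skip : ∀ {z} → z ∈ ys₁ ++ x ∷ ys₂ → x ≢ z → z ∈ ys₁ ++ ys₂
    skip z∈ x≢z with ∈-++⁻ ys₁ z∈
    ... | inj₁ z∈ys₁         = ∈-++⁺ˡ z∈ys₁
    ... | inj₂ (here refl)   = ⊥-elim (x≢z refl)
    ... | inj₂ (there z∈ys₂) = ∈-++⁺ʳ ys₁ z∈ys₂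

module FiniteDigraph {V : Set} (_≟_ : DecidableEquality V)
                     (vertices : List V) (∈-vertices : ∀ v → v ∈ vertices)
                     (Arc : V → V → Set) (Arc? : ∀ a b → Dec (Arc a b)) where

  open Data.Integer using (_+_; _-_; _*_; -_)

  open DecMembership _≟_ using (_∈?_)

  N : ℕ
  N = length vertices

  infixr 5 _∷_ _++ʷ_

  data Walk : V → V → Set where
    []  : ∀ {a} → Walk a a
    _∷_ : ∀ {a b c} → Arc a b → Walk b c → Walk a c

  len : ∀ {a b} → Walk a b → ℕ
  len []      = 0
  len (_ ∷ w) = suc (len w)

  weight : (V → V → ℤ) → ∀ {a b} → Walk a b → ℤ
  weight ω []                  = 0ℤ
  weight ω (_∷_ {a} {b} _ w) = ω a b + weight ω w

  visits : ∀ {a b} → Walk a b → List V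
  visits {a} []      = a ∷ []
  visits {a} (_ ∷ w) = a ∷ visits w

  _++ʷ_ : ∀ {a b c} → Walk a b → Walk b c → Walk a c
  []      ++ʷ w′ = w′
  (e ∷ w) ++ʷ w′ = e ∷ (w ++ʷ w′)

  len-++ʷ : ∀ {a b c} (w : Walk a b) (w′ : Walk b c) → len (w ++ʷ w′) ≡ len w ℕ.+ len w′
  len-++ʷ []      w′ = refl
  len-++ʷ (e ∷ w) w′ = cong suc (len-++ʷ w w′)

  weight-++ʷ : ∀ ω {a b c} (w : Walk a b) (w′ : Walk b c) →
               weight ω (w ++ʷ w′) ≡ weight ω w + weight ω w′
  weight-++ʷ ω []                w′ = sym (ℤP.+-identityˡ _)
  weight-++ʷ ω (_∷_ {a} {b} e w) w′ =
    trans (cong (λ z → ω a b + z) (weight-++ʷ ω w w′)) (sym (ℤP.+-assoc (ω a b) _ _))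

  weight-linear : ∀ f g (m : ℤ) {a b} (w : Walk a b) →
                  weight (λ x y → f x y + g x y * m) w ≡ weight f w + weight g w * m
  weight-linear f g m []                = refl
  weight-linear f g m (_∷_ {a} {b} _ w) =
    trans (cong (λ z → f a b + g a b * m + z) (weight-linear f g m w))
          (regroup (f a b) (g a b) (weight f w) (weight g w) m)
    where
      regroup : ∀ (x y z u m : ℤ) → x + y * m + (z + u * m) ≡ x + z + (y + u) * m
      regroup = solve-∀

  weight-const : ∀ (x : ℤ) {a b} (w : Walk a b) → weight (λ _ _ → x) w ≡ x * + len w
  weight-const x []      = sym (ℤP.*-zeroʳ x)
  weight-const x (_ ∷ w) = begin
    x + weight (λ _ _ → x) w  ≡⟨ cong (λ z → x + z) (weight-const x w) ⟩
    x + x * + len w           ≡⟨ sym (ℤP.*-suc x (+ len w)) ⟩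
    x * + suc (len w)         ∎
    where open ≡-Reasoning

  weight-telescopes : ∀ (h : V → ℤ) {a b} (w : Walk a b) → weight (λ x y → h y - h x) w ≡ h b - h a
  weight-telescopes h {a} []                = sym (ℤP.+-inverseʳ (h a))
  weight-telescopes h {a} {c} (_∷_ {b = b} _ w) =
    trans (cong (λ z → h b - h a + z) (weight-telescopes h w)) (cancel (h a) (h b) (h c))
    where
      cancel : ∀ (x y z : ℤ) → y - x + (z - y) ≡ z - x
      cancel = solve-∀

  weight-lowerBound : ∀ f (x : ℤ) → (∀ {a b} → Arc a b → x ℤ.≤ f a b) →
                      ∀ {a b} (w : Walk a b) → x * + len w ℤ.≤ weight f w
  weight-lowerBound f x x≤f []      = ℤP.≤-reflexive (ℤP.*-zeroʳ x)
  weight-lowerBound f x x≤f (e ∷ w) = ℤP.≤-trans (ℤP.≤-reflexive (ℤP.*-suc x (+ len _)))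
    (ℤP.+-mono-≤ (x≤f e) (weight-lowerBound f x x≤f w))

  unique-len<N : ∀ {a b} (w : Walk a b) → Unique (visits w) → len w ℕ.< N
  unique-len<N w unique = subst (ℕ._≤ N) (length-visits w) (unique-length≤ unique (λ {v} _ → ∈-vertices v))
    where
      length-visits : ∀ {a b} (w : Walk a b) → length (visits w) ≡ suc (len w)
      length-visits []      = refl
      length-visits (_ ∷ w) = cong suc (length-visits w)

  splitAt : ∀ {a b c} (w : Walk a c) → b ∈ visits w →
            Σ[ w₁ ∈ Walk a b ] Σ[ w₂ ∈ Walk b c ] w ≡ w₁ ++ʷ w₂
  splitAt []      (here refl) = [] , [] , refl
  splitAt (e ∷ w) (here refl) = [] , e ∷ w , refl
  splitAt (e ∷ w) (there b∈w) with splitAt w b∈w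
  ... | w₁ , w₂ , refl = e ∷ w₁ , w₂ , refl

  record CycleSplit {a b} (w : Walk a b) : Set where
    field
      {v}     : V
      before  : Walk a v
      cycle   : Walk v v
      after   : Walk v b
      nonempty : 1 ℕ.≤ len cycle
      short    : len cycle ℕ.≤ N
      split    : w ≡ before ++ʷ cycle ++ʷ after

  uniqueOrCycle : ∀ {a b} (w : Walk a b) → Unique (visits w) ⊎ CycleSplit w
  uniqueOrCycle []        = inj₁ (All.[] ∷ [])
  uniqueOrCycle {a} (e ∷ w) with uniqueOrCycle w
  ... | inj₂ s = inj₂ record { before = e ∷ before ; cycle = cycle ; after = after
                             ; nonempty = nonempty ; short = short ; split = cong (e ∷_) split }
    where open CycleSplit s
  ... | inj₁ unique with a ∈? visits w
  ...   | no a∉w  = inj₁ (¬Any⇒All¬ _ a∉w ∷ unique)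
  ...   | yes a∈w with splitAt w a∈w
  ...     | w₁ , w₂ , refl = inj₂ record
    { before = [] ; cycle = e ∷ w₁ ; after = w₂ ; nonempty = s≤s z≤n ; split = refl
    ; short  = ℕP.≤-trans (s≤s (subst (len w₁ ℕ.≤_) (sym (len-++ʷ w₁ w₂)) (ℕP.m≤m+n _ _)))
                          (unique-len<N (w₁ ++ʷ w₂) unique) }

  module _ {a b} {w : Walk a b} (s : CycleSplit w) where
    open CycleSplit s

    shortcut : Walk a b
    shortcut = before ++ʷ after

    len-shortcut< : len shortcut ℕ.< len w
    len-shortcut< = begin-strict
      len (before ++ʷ after)                        ≡⟨ len-++ʷ before after ⟩
      len before ℕ.+ len after                      <⟨ ℕP.+-monoʳ-< (len before) (ℕP.m<n+m (len after) nonempty) ⟩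
      len before ℕ.+ (len cycle ℕ.+ len after)      ≡⟨ cong (len before ℕ.+_) (sym (len-++ʷ cycle after)) ⟩
      len before ℕ.+ len (cycle ++ʷ after)          ≡⟨ sym (len-++ʷ before (cycle ++ʷ after)) ⟩
      len (before ++ʷ cycle ++ʷ after)              ≡⟨ cong len (sym split) ⟩
      len w                                         ∎
      where open ℕP.≤-Reasoning

    weight-shortcut : ∀ ω → weight ω w ≡ weight ω shortcut + weight ω cycle
    weight-shortcut ω = begin
      weight ω w                                    ≡⟨ cong (weight ω) split ⟩
      weight ω (before ++ʷ cycle ++ʷ after)         ≡⟨ weight-++ʷ ω before (cycle ++ʷ after) ⟩
      weight ω before + weight ω (cycle ++ʷ after)  ≡⟨ cong (λ z → weight ω before + z) (weight-++ʷ ω cycle after) ⟩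
      weight ω before + (weight ω cycle + weight ω after)
        ≡⟨ swap (weight ω before) (weight ω cycle) (weight ω after) ⟩
      weight ω before + weight ω after + weight ω cycle
        ≡⟨ cong (_+ weight ω cycle) (sym (weight-++ʷ ω before after)) ⟩
      weight ω shortcut + weight ω cycle            ∎
      where
        open ≡-Reasoning
        swap : ∀ (x y z : ℤ) → x + (y + z) ≡ x + z + y
        swap = solve-∀

  module _ (ω : V → V → ℤ) where

    PositiveCycle : Set
    PositiveCycle = Σ[ v ∈ V ] Σ[ C ∈ Walk v v ] len C ℕ.≤ N × 0ℤ ℤ.< weight ω C

    dominatedByShortWalk : ¬ PositiveCycle → ∀ {a b} (w : Walk a b) →
                           Σ[ w′ ∈ Walk a b ] len w′ ℕ.< N × weight ω w ℤ.≤ weight ω w′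
    dominatedByShortWalk noPositiveCycle w = go (len w) w ℕP.≤-refl
      where
        go : ∀ m {a b} (w : Walk a b) → len w ℕ.≤ m →
             Σ[ w′ ∈ Walk a b ] len w′ ℕ.< N × weight ω w ℤ.≤ weight ω w′
        go m w len≤m with uniqueOrCycle w
        go m w len≤m | inj₁ unique = w , unique-len<N w unique , ℤP.≤-refl
        go zero    w len≤0 | inj₂ s = ⊥-elim (ℕP.<⇒≱ (ℕP.≤-<-trans z≤n (len-shortcut< s)) len≤0)
        go (suc m) w len≤m | inj₂ s with 0ℤ ℤ.<? weight ω (CycleSplit.cycle s)
        ... | yes positive = ⊥-elim (noPositiveCycle (_ , CycleSplit.cycle s , CycleSplit.short s , positive))
        ... | no nonpositive with go m (shortcut s) (ℕP.≤-pred (ℕP.<-≤-trans (len-shortcut< s) len≤m))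
        ...   | w′ , short , ≤w′ = w′ , short , (begin
          weight ω w                                           ≡⟨ weight-shortcut s ω ⟩
          weight ω (shortcut s) + weight ω (CycleSplit.cycle s) ≤⟨ ℤP.+-monoʳ-≤ (weight ω (shortcut s)) (ℤP.≮⇒≥ nonpositive) ⟩
          weight ω (shortcut s) + 0ℤ                           ≡⟨ ℤP.+-identityʳ _ ⟩
          weight ω (shortcut s)                                ≤⟨ ≤w′ ⟩
          weight ω w′                                          ∎)
          where open ℤP.≤-Reasoning

    private
      WalkFrom : V → Set
      WalkFrom a = Σ V (Walk a)

      gain : ∀ {a} → WalkFrom a → ℤ
      gain (_ , w) = weight ω w

      open Extrema ℤP.≤-totalOrder using (argmax; f[⊥]≤f[argmax]; f[xs]≤f[argmax])

      longest : ℕ → (a : V) → WalkFrom a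
      extend  : ℕ → (a b : V) → WalkFrom a

      longest zero    a = a , []
      longest (suc t) a = argmax gain (longest t a) (map (extend t a) vertices)

      extend t a b with Arc? a b
      ... | yes e = _ , e ∷ proj₂ (longest t b)
      ... | no  _ = longest t a

      gain-extend : ∀ t {a b} → Arc a b → gain (extend t a b) ≡ ω a b + gain (longest t b)
      gain-extend t {a} {b} e with Arc? a b
      ... | yes _ = refl
      ... | no ¬e = ⊥-elim (¬e e)

      0≤gain-longest : ∀ t a → 0ℤ ℤ.≤ gain (longest t a)
      0≤gain-longest zero    a = ℤP.≤-refl
      0≤gain-longest (suc t) a =
        ℤP.≤-trans (0≤gain-longest t a) (f[⊥]≤f[argmax] {f = gain} (longest t a) (map (extend t a) vertices))

      longest-maximal : ∀ t {a b} (w : Walk a b) → len w ℕ.≤ t → weight ω w ℤ.≤ gain (longest t a)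
      longest-maximal t       []                   _           = 0≤gain-longest t _
      longest-maximal (suc t) {a} (_∷_ {b = b} e w) (s≤s len≤t) = begin
        ω a b + weight ω w         ≤⟨ ℤP.+-monoʳ-≤ (ω a b) (longest-maximal t w len≤t) ⟩
        ω a b + gain (longest t b) ≡⟨ sym (gain-extend t e) ⟩
        gain (extend t a b)        ≤⟨ All.lookup (f[xs]≤f[argmax] {f = gain} (longest t a) _)
                                                 (∈-map⁺ (extend t a) (∈-vertices b)) ⟩
        gain (longest (suc t) a)   ∎
        where open ℤP.≤-Reasoning

    potential : ¬ PositiveCycle → Σ[ π ∈ (V → ℤ) ] (∀ {a b} → Arc a b → ω a b + π b ℤ.≤ π a)
    potential noPositiveCycle = (λ a → gain (longest N a)) , λ {a} {b} e →
      let w′ , short , ≤w′ = dominatedByShortWalk noPositiveCycle (e ∷ proj₂ (longest N b))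
      in  ℤP.≤-trans ≤w′ (longest-maximal N w′ (ℕP.<⇒≤ short))

opposite : Sgn → Sgn
opposite pos = neg
opposite neg = pos

_·_ : Sgn → Sgn → Sgn
pos · t   = t
neg · pos = neg
neg · neg = pos

·-comm : ∀ s t → s · t ≡ t · s
·-comm pos pos = refl
·-comm pos neg = refl
·-comm neg pos = refl
·-comm neg neg = refl

opposite-· : ∀ s t → opposite s · opposite t ≡ s · t
opposite-· pos pos = refl
opposite-· pos neg = refl
opposite-· neg pos = refl
opposite-· neg neg = refl

_≟ˢ_ : DecidableEquality Sgn
pos ≟ˢ pos = yes refl
pos ≟ˢ neg = no λ ()
neg ≟ˢ pos = no λ ()
neg ≟ˢ neg = yes refl

-- The vertex (v , s) of the double cover stands for s · c(v); an edge vw of sign σ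
-- lifts to the arcs (v , s) → (w , t) with s · t = σ.
module DoubleCover {n} (G : SignedGraph n) where

  open Data.Integer using (_+_; _-_; _*_; -_)

  Vertex : Set
  Vertex = Fin n × Sgn

  vertices : List Vertex
  vertices = map (_, pos) (allFin n) ++ map (_, neg) (allFin n)

  ∈-vertices : ∀ a → a ∈ vertices
  ∈-vertices (v , pos) = ∈-++⁺ˡ (∈-map⁺ (_, pos) (∈-allFin v))
  ∈-vertices (v , neg) = ∈-++⁺ʳ (map (_, pos) (allFin n)) (∈-map⁺ (_, neg) (∈-allFin v))

  length-vertices : length vertices ≡ n ℕ.+ n
  length-vertices = trans (length-++ (map (_, pos) (allFin n)))
    (cong₂ ℕ._+_ (trans (length-map _ (allFin n)) (length-tabulate {n = n} id))
                 (trans (length-map _ (allFin n)) (length-tabulate {n = n} id)))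

  Arc : Vertex → Vertex → Set
  Arc (v , s) (w , t) = sign G v w ≡ just (s · t)

  Arc? : ∀ a b → Dec (Arc a b)
  Arc? (v , s) (w , t) = MaybeP.≡-dec _≟ˢ_ (sign G v w) (just (s · t))

  flip : Vertex → Vertex
  flip (v , s) = v , opposite s

  Arc-sym : ∀ {a b} → Arc a b → Arc b a
  Arc-sym {v , s} {w , t} e = trans (symm G w v) (trans e (cong just (·-comm s t)))

  Arc-flip : ∀ {a b} → Arc a b → Arc (flip b) (flip a)
  Arc-flip {v , s} {w , t} e = trans (Arc-sym {v , s} {w , t} e) (cong just (sym (opposite-· t s)))

  open FiniteDigraph (≡-dec FinP._≟_ _≟ˢ_) vertices ∈-vertices Arc Arc? public

  arc-difference : ∀ s t (x y : ℤ) → sgnℤ t * y - sgnℤ s * x ≡ sgnℤ (opposite s) * (x - sgnℤ (s · t) * y)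
  arc-difference pos pos = solve-∀
  arc-difference pos neg = solve-∀
  arc-difference neg pos = solve-∀
  arc-difference neg neg = solve-∀

  module Winding {K D : ℕ} .{{_ : NonZero K}} (c : Fin n → Fin K) (coloring : IsColoring G K D c) where

    value : Vertex → ℤ
    value (v , s) = sgnℤ s * + toℕ (c v)

    difference : Vertex → Vertex → ℤ
    difference a b = value b - value a

    shift : Vertex → Vertex → ℕ
    shift a b = difference a b %ℕ K

    winding : Vertex → Vertex → ℤ
    winding a b = - (difference a b /ℕ K)

    shift≡ : ∀ a b → + shift a b ≡ difference a b + winding a b * + K
    shift≡ a b = trans (sym (cancel (+ shift a b) (difference a b /ℕ K) (+ K)))
                       (cong (λ z → z + winding a b * + K) (sym (a≡a%ℕn+[a/ℕn]*n (difference a b) K)))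
      where
        cancel : ∀ (r q k : ℤ) → r + q * k + - q * k ≡ r
        cancel = solve-∀

    D≤shift : ∀ {a b} → Arc a b → D ℕ.≤ shift a b
    D≤shift {v , s} {w , t} e = ℕP.≤-trans (coloring v w (s · t) e)
      (subst (λ z → circAbs K (cv - sgnℤ (s · t) * cw) ℕ.≤ z %ℕ K) (sym (arc-difference s t cv cw))
             (circAbs≤%ℕ (opposite s) (cv - sgnℤ (s · t) * cw)))
      where
        cv = + toℕ (c v)
        cw = + toℕ (c w)

    winding-reverse : 1 ℕ.≤ D → ∀ {a b} → Arc a b → winding a b + winding b a ≡ 1ℤ
    winding-reverse 1≤D {a} {b} e = multiple-of-k≡k {k = K} (winding a b + winding b a)
      (sym (begin
        + (shift a b ℕ.+ shift b a)                 ≡⟨ ℤP.pos-+ (shift a b) (shift b a) ⟩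
        + shift a b + + shift b a                   ≡⟨ cong₂ _+_ (shift≡ a b) (shift≡ b a) ⟩
        difference a b + winding a b * + K + (difference b a + winding b a * + K)
                                                    ≡⟨ cancel (value a) (value b) (winding a b) (winding b a) (+ K) ⟩
        (winding a b + winding b a) * + K           ∎))
      (ℕP.<-≤-trans 1≤D (ℕP.≤-trans (D≤shift {a} {b} e) (ℕP.m≤m+n _ _)))
      (ℕP.+-mono-< (n%ℕd<d (difference a b) K) (n%ℕd<d (difference b a) K))
      where
        open ≡-Reasoning
        cancel : ∀ (x y u v k : ℤ) → y - x + u * k + (x - y + v * k) ≡ (u + v) * k
        cancel = solve-∀

    winding-flip : ∀ a b → winding (flip b) (flip a) ≡ winding a b
    winding-flip (v , s) (w , t) = cong (λ z → - (z /ℕ K)) (flipped s t _ _)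
      where
        flipped : ∀ s t (x y : ℤ) → sgnℤ (opposite s) * x - sgnℤ (opposite t) * y ≡ sgnℤ t * y - sgnℤ s * x
        flipped pos pos = solve-∀
        flipped pos neg = solve-∀
        flipped neg pos = solve-∀
        flipped neg neg = solve-∀

    cycle-winding : ∀ {v} (C : Walk v v) → + D * + len C ℤ.≤ weight winding C * + K
    cycle-winding {v} C = begin
      + D * + len C
        ≤⟨ weight-lowerBound shift′ (+ D) (λ {a} {b} e → subst (+ D ℤ.≤_) (shift≡ a b) (ℤ.+≤+ (D≤shift {a} {b} e))) C ⟩
      weight shift′ C
        ≡⟨ weight-linear difference winding (+ K) C ⟩
      weight difference C + weight winding C * + K
        ≡⟨ cong (_+ weight winding C * + K) (trans (weight-telescopes value C) (ℤP.+-inverseʳ (value v))) ⟩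
      0ℤ + weight winding C * + K
        ≡⟨ ℤP.+-identityˡ _ ⟩
      weight winding C * + K  ∎
      where
        open ℤP.≤-Reasoning
        shift′ : Vertex → Vertex → ℤ
        shift′ a b = difference a b + winding a b * + K

  residue : ∀ k .{{_ : NonZero k}} → ℤ → Fin k
  residue k x = fromℕ< (n%ℕd<d x k)

  coloringFromLabels : ∀ {k d} .{{_ : NonZero k}} (Q : Vertex → ℤ) (m : Vertex → Vertex → ℤ) →
    (∀ v → Q (v , neg) ≡ - Q (v , pos)) →
    (∀ {a b} → Arc a b → m a b + m b a ≡ 1ℤ) →
    (∀ {a b} → Arc a b → + d ℤ.≤ Q a - Q b + m a b * + k) →
    IsColoring G k d (λ v → residue k (Q (v , pos)))
  coloringFromLabels {k} {d} Q m Q-flip m-reverse lower v w s e =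
    subst (λ x → d ℕ.≤ circAbs k x) (sym edge≡) (≤-circAbsᶻ t (lower e) upper)
    where
      a b : Vertex
      a = v , pos
      b = w , s

      Q-sign : ∀ s → Q (w , s) ≡ sgnℤ s * Q (w , pos)
      Q-sign pos = sym (ℤP.*-identityˡ _)
      Q-sign neg = trans (Q-flip w) (sym (ℤP.-1*i≡-i _))

      upper : Q a - Q b + m a b * + k ℤ.≤ + k - + d
      upper = begin
        Q a - Q b + m a b * + k
          ≡⟨ reverse (Q a) (Q b) (m a b) (m b a) (+ k) ⟩
        (m a b + m b a) * + k - (Q b - Q a + m b a * + k)
          ≡⟨ cong (λ z → z * + k - (Q b - Q a + m b a * + k)) (m-reverse e) ⟩
        1ℤ * + k - (Q b - Q a + m b a * + k)
          ≤⟨ ℤP.+-monoʳ-≤ (1ℤ * + k) (ℤP.neg-mono-≤ (lower (Arc-sym {a} {b} e))) ⟩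
        1ℤ * + k - + d
          ≡⟨ cong (_- + d) (ℤP.*-identityˡ (+ k)) ⟩
        + k - + d  ∎
        where
          open ℤP.≤-Reasoning
          reverse : ∀ (x y u v k : ℤ) → x - y + u * k ≡ (u + v) * k - (y - x + v * k)
          reverse = solve-∀

      t : ℤ
      t = sgnℤ s * (Q (w , pos) /ℕ k) - Q a /ℕ k - m a b

      edge≡ : + toℕ (residue k (Q a)) - sgnℤ s * + toℕ (residue k (Q (w , pos))) ≡ Q a - Q b + m a b * + k + t * + k
      edge≡ = begin
        + toℕ (residue k (Q a)) - sgnℤ s * + toℕ (residue k (Q (w , pos)))
          ≡⟨ cong₂ (λ x y → + x - sgnℤ s * + y) (FinP.toℕ-fromℕ< _) (FinP.toℕ-fromℕ< _) ⟩
        + (Q a %ℕ k) - sgnℤ s * + (Q (w , pos) %ℕ k)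
          ≡⟨ cong₂ (λ x y → x - sgnℤ s * y) (remainder (Q a)) (remainder (Q (w , pos))) ⟩
        (Q a - Q a /ℕ k * + k) - sgnℤ s * (Q (w , pos) - Q (w , pos) /ℕ k * + k)
          ≡⟨ regroup (Q a) (Q (w , pos)) (sgnℤ s) (Q a /ℕ k) (Q (w , pos) /ℕ k) (m a b) (+ k) ⟩
        Q a - sgnℤ s * Q (w , pos) + m a b * + k + t * + k
          ≡⟨ cong (λ z → Q a - z + m a b * + k + t * + k) (sym (Q-sign s)) ⟩
        Q a - Q b + m a b * + k + t * + k   ∎
        where
          open ≡-Reasoning
          remainder : ∀ x → + (x %ℕ k) ≡ x - x /ℕ k * + k
          remainder x = trans (sym (cancel (+ (x %ℕ k)) (x /ℕ k * + k)))
                              (cong (_- x /ℕ k * + k) (sym (a≡a%ℕn+[a/ℕn]*n x k)))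
            where
              cancel : ∀ (r z : ℤ) → r + z - z ≡ r
              cancel = solve-∀
          regroup : ∀ (x y σ A B u k : ℤ) →
                    (x - A * k) - σ * (y - B * k) ≡ x - σ * y + u * k + (σ * B - A - u) * k
          regroup = solve-∀

1≤2* : ∀ {q} → 1 ℕ.≤ q → 1 ℕ.≤ 2 ℕ.* q
1≤2* {q} 1≤q = ℕP.≤-trans 1≤q (ℕP.m≤m+n q (q ℕ.+ 0))

toHasColoring : ∀ {n} {G : SignedGraph n} {k d} .{{_ : NonZero k}} → 1 ℕ.≤ d → 2 ℕ.* d ℕ.≤ k →
                (c : Fin n → Fin k) → IsColoring G k d c → HasColoring G k d
toHasColoring {k = suc _} 1≤d 2d≤k c coloring = 1≤d , 2d≤k , c , coloring

SmallColoring : ∀ {n} → SignedGraph n → ℕ × ℕ → Set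
SmallColoring {n} G (k , d) = k ℕ.≤ 4 ℕ.* n × HasColoring G k d

module Compression {n} (G : SignedGraph n) {K′ D : ℕ} (1≤D : 1 ℕ.≤ D)
                   (c : Fin n → Fin (suc K′)) (coloring : IsColoring G (suc K′) D c) where

  open Data.Integer using (_+_; _-_; _*_; -_)

  open DoubleCover G
  open Winding c coloring

  K : ℕ
  K = suc K′

  Admissible : ℕ × ℕ → Set
  Admissible (p , q) = 1 ℕ.≤ q × 2 ℕ.* q ℕ.≤ p × p ℕ.≤ N × p ℕ.* D ℕ.≤ K ℕ.* q

  admissible? : Decidable Admissible
  admissible? (p , q) = (1 ℕ.≤? q) ×-dec (2 ℕ.* q ℕ.≤? p) ×-dec (p ℕ.≤? N) ×-dec (p ℕ.* D ℕ.≤? K ℕ.* q)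

  module _ {p q : ℕ} (admissible : Admissible (p , q))
           (maximal : ∀ {L W} → (L , W) ∈ pairsUpTo N → Admissible (L , W) → L ÷ W ℚ.≤ p ÷ q) where

    private
      1≤q : 1 ℕ.≤ q
      1≤q = proj₁ admissible

      2q≤p : 2 ℕ.* q ℕ.≤ p
      2q≤p = proj₁ (proj₂ admissible)

    ω : Vertex → Vertex → ℤ
    ω a b = + q + winding a b * - + p

    no-better-ratio : ∀ {L W} → L ℕ.≤ N → D ℕ.* L ℕ.≤ W ℕ.* K → ¬ (p ℕ.* W ℕ.< q ℕ.* L)
    no-better-ratio {L} {zero} L≤N DL≤0 pW<qL = ℕP.<⇒≱ (ℕP.*-mono-≤ 1≤D 1≤L) DL≤0
      where
        1≤L : 1 ℕ.≤ L
        1≤L = ℕP.≰⇒> λ L≤0 → ℕP.<⇒≱ pW<qL (ℕP.≤-trans (ℕP.*-monoʳ-≤ q L≤0)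
                                   (ℕP.≤-reflexive (trans (ℕP.*-zeroʳ q) (sym (ℕP.*-zeroʳ p)))))
    no-better-ratio {L} {W@(suc _)} L≤N DL≤WK pW<qL =
      ℕP.<⇒≱ pW<qL (subst (ℕ._≤ p ℕ.* W) (ℕP.*-comm L q)
                          (÷-≤⁻ (s≤s z≤n) 1≤q (maximal (∈-pairsUpTo L≤N W≤N) admissibleLW)))
      where
        2W<L : 2 ℕ.* W ℕ.< L
        2W<L = ℕP.*-cancelˡ-< q _ _
                 (ℕP.≤-<-trans (ℕP.≤-trans (ℕP.≤-reflexive (assoc q W)) (ℕP.*-monoˡ-≤ W 2q≤p)) pW<qL)
          where
            assoc : ∀ q w → q ℕ.* (2 ℕ.* w) ≡ 2 ℕ.* q ℕ.* w
            assoc = ℕSolver.solve-∀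
        W≤N : W ℕ.≤ N
        W≤N = ℕP.≤-trans (ℕP.m≤m+n W (W ℕ.+ 0)) (ℕP.≤-trans (ℕP.<⇒≤ 2W<L) L≤N)
        admissibleLW : Admissible (L , W)
        admissibleLW = s≤s z≤n , ℕP.<⇒≤ 2W<L , L≤N , subst₂ ℕ._≤_ (ℕP.*-comm D L) (ℕP.*-comm W K) DL≤WK

    noPositiveCycle : ¬ PositiveCycle ω
    noPositiveCycle (v , C , short , positive) =
      impossible (weight winding C) (subst (ℤ._≤ weight winding C * + K) (sym (ℤP.pos-* D (len C))) (cycle-winding C))
                 (subst (0ℤ ℤ.<_) (weight-ω C) positive)
      where
        weight-ω : ∀ {a b} (w : Walk a b) → weight ω w ≡ + q * + len w + weight winding w * - + p
        weight-ω w = trans (weight-linear (λ _ _ → + q) winding (- + p) w)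
                           (cong (_+ weight winding w * - + p) (weight-const (+ q) w))
        impossible : ∀ W → + (D ℕ.* len C) ℤ.≤ W * + K → ¬ (0ℤ ℤ.< + q * + len C + W * - + p)
        impossible (+ W) DL≤WK positive =
          no-better-ratio short (ℤP.drop‿+≤+ (subst (+ (D ℕ.* len C) ℤ.≤_) (sym (ℤP.pos-* W K)) DL≤WK))
            (ℕP.≰⇒> λ qL≤pW → ℤP.<⇒≱ positive
              (ℤP.≤-trans (ℤP.≤-reflexive (rearrange q (len C) W p)) (ℤP.i≤j⇒i-j≤0 (ℤ.+≤+ qL≤pW))))
          where
            rearrange : ∀ q L W p → + q * + L + + W * - + p ≡ + (q ℕ.* L) - + (p ℕ.* W)
            rearrange q L W p = trans (swap (+ q) (+ L) (+ W) (+ p)) (sym (cong₂ _-_ (ℤP.pos-* q L) (ℤP.pos-* p W)))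
              where
                swap : ∀ (q L W p : ℤ) → q * L + W * - p ≡ q * L - p * W
                swap = solve-∀
        impossible -[1+ W ] () _

    private
      π : Vertex → ℤ
      π = proj₁ (potential ω noPositiveCycle)

      feasible : ∀ {a b} → Arc a b → ω a b + π b ℤ.≤ π a
      feasible = proj₂ (potential ω noPositiveCycle)

    label : Vertex → ℤ
    label a = π a - π (flip a)

    label-flip : ∀ v → label (v , neg) ≡ - label (v , pos)
    label-flip v = antisymmetric (π (v , neg)) (π (v , pos))
      where
        antisymmetric : ∀ (x y : ℤ) → x - y ≡ - (y - x)
        antisymmetric = solve-∀

    label-gap : ∀ {a b} → Arc a b → + (2 ℕ.* q) ℤ.≤ label a - label b + winding a b * + (2 ℕ.* p)
    label-gap {a} {b} e = begin
      + (2 ℕ.* q)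
        ≡⟨ ℤP.pos-* 2 q ⟩
      + 2 * + q
        ≡⟨ expand (+ q) (+ p) w (π b) (π (flip a)) ⟩
      (ω a b + π b) + (ω a b + π (flip a)) - (π b + π (flip a)) + w * (+ 2 * + p)
        ≤⟨ ℤP.+-monoˡ-≤ _ (ℤP.+-monoˡ-≤ _ (ℤP.+-mono-≤ (feasible e) along-flip)) ⟩
      π a + π (flip b) - (π b + π (flip a)) + w * (+ 2 * + p)
        ≡⟨ regroup (π a) (π b) (π (flip a)) (π (flip b)) (w * (+ 2 * + p)) ⟩
      label a - label b + w * (+ 2 * + p)
        ≡⟨ cong (λ z → label a - label b + w * z) (sym (ℤP.pos-* 2 p)) ⟩
      label a - label b + w * + (2 ℕ.* p)  ∎
      where
        open ℤP.≤-Reasoning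
        w = winding a b
        along-flip : ω a b + π (flip a) ℤ.≤ π (flip b)
        along-flip = subst (λ z → + q + z * - + p + π (flip a) ℤ.≤ π (flip b)) (winding-flip a b)
                           (feasible (Arc-flip {a} {b} e))
        expand : ∀ (q p w x y : ℤ) → + 2 * q ≡ (q + w * - p + x) + (q + w * - p + y) - (x + y) + w * (+ 2 * p)
        expand = solve-∀
        regroup : ∀ (x y fx fy z : ℤ) → x + fy - (y + fx) + z ≡ x - fx - (y - fy) + z
        regroup = solve-∀

    doubledColoring : HasColoring G (2 ℕ.* p) (2 ℕ.* q)
    doubledColoring = toHasColoring (1≤2* 1≤q) (ℕP.*-monoʳ-≤ 2 2q≤p) _
      (coloringFromLabels label winding label-flip (λ {a} {b} → winding-reverse 1≤D {a} {b}) label-gap)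
      where
        instance
          2p≢0 : NonZero (2 ℕ.* p)
          2p≢0 = ℕ.>-nonZero (ℕP.≤-trans (1≤2* 1≤q) (ℕP.≤-trans 2q≤p (ℕP.m≤m+n p (p ℕ.+ 0))))

  admissible-2,1 : 1 ℕ.≤ n → 2 ℕ.* D ℕ.≤ K → Admissible (2 , 1)
  admissible-2,1 1≤n 2D≤K = ℕP.≤-refl , ℕP.≤-refl , subst (2 ℕ.≤_) (sym length-vertices) (ℕP.+-mono-≤ 1≤n 1≤n) ,
                            subst (2 ℕ.* D ℕ.≤_) (sym (ℕP.*-identityʳ K)) 2D≤K

  compress : 1 ℕ.≤ n → 2 ℕ.* D ℕ.≤ K →
             Σ (ℕ × ℕ) λ (k , d) → SmallColoring G (k , d) × k ÷ d ℚ.≤ K ÷ D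
  compress 1≤n 2D≤K
    with maximiser ℚP.≤-totalOrder (λ (p , q) → p ÷ q) admissible? (2 , 1) (admissible-2,1 1≤n 2D≤K) (pairsUpTo N)
  ... | (p , q) , admissible@(1≤q , _ , p≤N , pD≤Kq) , maximal =
    (2 ℕ.* p , 2 ℕ.* q) , (2p≤4n , doubledColoring admissible (λ {L} {W} → maximal {L , W})) ,
    ÷-≤⁺ (1≤2* 1≤q) 1≤D (begin
      2 ℕ.* p ℕ.* D     ≡⟨ ℕP.*-assoc 2 p D ⟩
      2 ℕ.* (p ℕ.* D)   ≤⟨ ℕP.*-monoʳ-≤ 2 pD≤Kq ⟩
      2 ℕ.* (K ℕ.* q)   ≡⟨ ℕP.*-comm 2 (K ℕ.* q) ⟩
      K ℕ.* q ℕ.* 2     ≡⟨ ℕP.*-assoc K q 2 ⟩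
      K ℕ.* (q ℕ.* 2)   ≡⟨ cong (K ℕ.*_) (ℕP.*-comm q 2) ⟩
      K ℕ.* (2 ℕ.* q)   ∎)
    where
      open ℕP.≤-Reasoning
      2p≤4n : 2 ℕ.* p ℕ.≤ 4 ℕ.* n
      2p≤4n = begin
        2 ℕ.* p           ≤⟨ ℕP.*-monoʳ-≤ 2 (subst (p ℕ.≤_) length-vertices p≤N) ⟩
        2 ℕ.* (n ℕ.+ n)   ≡⟨ double n ⟩
        4 ℕ.* n           ∎
        where
          double : ∀ n → 2 ℕ.* (n ℕ.+ n) ≡ 4 ℕ.* n
          double = ℕSolver.solve-∀

module _ {n} (G : SignedGraph n) where

  open Data.Integer using (_+_; _-_; _*_; -_)

  private
    onEdge? : (σ : Maybe Sgn) {Q : Sgn → Set} → Decidable Q → Dec (∀ s → σ ≡ just s → Q s)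
    onEdge? nothing  Q? = yes λ _ ()
    onEdge? (just s) Q? with Q? s
    ... | yes Qs = yes λ { _ refl → Qs }
    ... | no ¬Qs = no λ Q → ¬Qs (Q s refl)

    isColoring? : ∀ k .{{_ : NonZero k}} d → Decidable (IsColoring G k d)
    isColoring? k d c = FinP.all? λ v → FinP.all? λ w → onEdge? (sign G v w)
      λ s → d ℕ.≤? circAbs k (+ toℕ (c v) - sgnℤ s * + toℕ (c w))

    isColoring-resp : ∀ {k} .{{_ : NonZero k}} {d} {c c′ : Fin n → Fin k} →
                      (∀ v → c v ≡ c′ v) → IsColoring G k d c → IsColoring G k d c′
    isColoring-resp {k} {d = d} c≗c′ coloring v w s e =
      subst₂ (λ x y → d ℕ.≤ circAbs k (+ toℕ x - sgnℤ s * + toℕ y)) (c≗c′ v) (c≗c′ w) (coloring v w s e)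

  hasColoring-bounds : ∀ {k d} → HasColoring G k d → 1 ℕ.≤ d × d ℕ.≤ k
  hasColoring-bounds {suc _} {d} (1≤d , 2d≤k , _) = 1≤d , ℕP.≤-trans (ℕP.m≤m+n d (d ℕ.+ 0)) 2d≤k

  hasColoring? : ∀ k d → Dec (HasColoring G k d)
  hasColoring? zero    d = no λ ()
  hasColoring? (suc k) d =
    (1 ℕ.≤? d) ×-dec (2 ℕ.* d ℕ.≤? suc k) ×-dec anyFunction? isColoring-resp (isColoring? (suc k) d)

  trivialColoring : 1 ℕ.≤ n → HasColoring G (suc (n ℕ.+ n)) 1
  trivialColoring 1≤n = ℕP.≤-refl , s≤s (ℕP.≤-trans 1≤n (ℕP.m≤m+n n n)) , c , coloring
    where
      k : ℕ
      k = suc (n ℕ.+ n)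

      1+v<k : ∀ (v : Fin n) → suc (toℕ v) ℕ.< k
      1+v<k v = s≤s (ℕP.≤-trans (FinP.toℕ<n v) (ℕP.m≤m+n n n))

      c : Fin n → Fin k
      c v = fromℕ< (1+v<k v)

      coloring : IsColoring G k 1 c
      coloring v w s e rewrite FinP.toℕ-fromℕ< (1+v<k v) | FinP.toℕ-fromℕ< (1+v<k w) = edge s e
        where
          a b : ℕ
          a = suc (toℕ v)
          b = suc (toℕ w)

          edge : ∀ s → sign G v w ≡ just s → 1 ℕ.≤ circAbs k (+ a - sgnℤ s * + b)
          edge pos e = subst (λ x → 1 ℕ.≤ circAbs k x) (sym difference≡)
            (1≤circAbs-⊖ (1+v<k v) (1+v<k w) λ a≡b → v≢w (FinP.toℕ-injective (ℕP.suc-injective a≡b)))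
            where
              difference≡ : + a - + 1 * + b ≡ a ⊖ b
              difference≡ = trans (cong (λ z → + a - z) (ℤP.*-identityˡ (+ b))) (ℤP.m-n≡m⊖n a b)
              v≢w : v ≢ w
              v≢w refl with trans (sym e) (irrefl G v)
              ... | ()
          edge neg _ = subst (λ x → 1 ℕ.≤ circAbs k x) (sym sum≡)
            (1≤circAbs-⊖ (s≤s (ℕP.+-mono-≤ (FinP.toℕ<n v) (FinP.toℕ<n w))) (s≤s z≤n) λ ())
            where
              flipSign : ∀ (x y : ℤ) → x - (- 1ℤ) * y ≡ x + y
              flipSign = solve-∀
              sum≡ : + a - (- 1ℤ) * + b ≡ (a ℕ.+ b) ⊖ 0
              sum≡ = trans (flipSign (+ a) (+ b)) (trans (sym (ℤP.pos-+ a b)) (sym (ℤP.⊖-≥ z≤n)))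

  smallColoring? : Decidable (SmallColoring G)
  smallColoring? (k , d) = (k ℕ.≤? 4 ℕ.* n) ×-dec hasColoring? k d

  leastSmallRatio : 1 ℕ.≤ n → Σ (ℕ × ℕ) λ (k , d) → SmallColoring G (k , d) ×
                    (∀ {k′ d′} → SmallColoring G (k′ , d′) → k ÷ d ℚ.≤ k′ ÷ d′)
  leastSmallRatio 1≤n =
    let r , small , minimal = minimiser ℚP.≤-totalOrder (λ (k , d) → k ÷ d) smallColoring?
                                        (suc (n ℕ.+ n) , 1) (2n+1≤4n , trivialColoring 1≤n) (pairsUpTo (4 ℕ.* n))
    in  r , small , λ {k′} {d′} small′@(k′≤4n , colorable) →
          minimal (∈-pairsUpTo k′≤4n (ℕP.≤-trans (proj₂ (hasColoring-bounds colorable)) k′≤4n)) small′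
    where
      2n+1≤4n : suc (n ℕ.+ n) ℕ.≤ 4 ℕ.* n
      2n+1≤4n = ℕP.≤-trans (ℕP.+-monoˡ-≤ (n ℕ.+ n) 1≤n) (ℕP.≤-trans (ℕP.m≤m+n _ n) (ℕP.≤-reflexive (quadruple n)))
        where
          quadruple : ∀ n → n ℕ.+ (n ℕ.+ n) ℕ.+ n ≡ 4 ℕ.* n
          quadruple = ℕSolver.solve-∀

  smallerRatio : 1 ℕ.≤ n → ∀ {k d} → HasColoring G k d →
                 Σ (ℕ × ℕ) λ (k″ , d″) → SmallColoring G (k″ , d″) × k″ ÷ d″ ℚ.≤ k ÷ d
  smallerRatio 1≤n {suc _} (1≤d , 2d≤k , c , coloring) = Compression.compress G 1≤d c coloring 1≤n 2d≤k

open import Data.Nat using (_≤_; _*_)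

theorem9 : (n : ℕ) → (G : SignedGraph n) → 1 ≤ n →
    Σ ℕ (λ k → Σ ℕ (λ d → k ≤ 4 * n × HasColoring G k d ×
    ((k′ d′ : ℕ) → HasColoring G k′ d′ → k * d′ ≤ k′ * d)))
theorem9 n G 1≤n =
  let (k , d) , (k≤4n , colorable) , least = leastSmallRatio G 1≤n
  in  k , d , k≤4n , colorable , λ k′ d′ colorable′ →
        let _ , small″ , k″/d″≤k′/d′ = smallerRatio G 1≤n colorable′
        in  ÷-≤⁻ (proj₁ (hasColoring-bounds G colorable)) (proj₁ (hasColoring-bounds G colorable′))
                 (ℚP.≤-trans (least small″) k″/d″≤k′/d′)
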